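{- Let $r,s \in \mathbb{N}$ and let $m$ be an integer. For all sufficiently large $n$, every graph $G$ on $n$ vertices with $D(G) \geq n+ 2r-m$ either contains a subgraph isomorphic to $K_{r,s}$ all of whose vertices have degree at least $\lceil (n-m)/2\rceil+r$ in $G$, or has an $r$-percolating set of size $r$.
   Context: In the $r$-neighbour bootstrap process on a graph $G$ with initially infected set $A_0\subseteq V(G)$, one sets $A_t=A_{t-1}\cup\{v\in V(G): |N(v)\cap A_{t-1}|\geq r\}$ for $t\geq 1$; $A_0$ is $r$-percolating if $A_t=V(G)$ for some $t$. $D(G)=\min\{\deg(v)+\deg(w): v\neq w\in V(G),\ v\not\sim w\}$, the minimum degree sum over pairs of distinct non-adjacent vertices. $K_{r,s}$ is the complete bipartite graph with parts of sizes $r$ and $s$. -}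

module Defs where

open import Data.Nat using (ℕ; zero; suc; _≤?_)
open import Data.Integer as ℤ using (ℤ; +_)
open import Data.Bool using (Bool; true; false; _∨_)
open import Data.Fin using (Fin)
open import Data.Fin.Subset using (Subset; _∩_; ∣_∣)
open import Data.Vec using (tabulate)
open import Relation.Binary.PropositionalEquality using (_≡_)
open import Relation.Nullary.Decidable using (⌊_⌋)

record Graph (n : ℕ) : Set where
  field
    adj   : Fin n → Fin n → Bool
    sym   : ∀ u v → adj u v ≡ adj v u
    irrefl : ∀ v → adj v v ≡ false
open Graph public

_∼_within_ : ∀ {n} → Fin n → Fin n → Graph n → Set
u ∼ v within G = adj G u v ≡ true

N : ∀ {n} → Graph n → Fin n → Subset n
N G v = tabulate (adj G v)

deg : ∀ {n} → Graph n → Fin n → ℕ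
deg G v = ∣ N G v ∣

-- one step of the r-neighbour bootstrap process
step : ∀ {n} → ℕ → Graph n → Subset n → Subset n
step r G A = tabulate (λ v → Data.Vec.lookup A v ∨ ⌊ r ≤? ∣ N G v ∩ A ∣ ⌋)

infected : ∀ {n} → ℕ → Graph n → Subset n → ℕ → Subset n
infected r G A zero = A
infected r G A (suc t) = step r G (infected r G A t)

Percolating : ∀ {n} → ℕ → Graph n → Subset n → Set
Percolating {n} r G A = Σ ℕ (λ t → infected r G A t ≡ Data.Fin.Subset.⊤)
  where open import Data.Product using (Σ)

-- D(G) ≥ d : every pair of distinct non-adjacent vertices has degree sum ≥ d
-- (vacuous for complete graphs, i.e. D(K_n) = ∞).
DAtLeast : ∀ {n} → Graph n → ℤ → Set
DAtLeast G d = ∀ v w → ¬ (v ≡ w) → ¬ (v ∼ w within G) → d ℤ.≤ + (deg G v ℕ+ deg G w)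
  where
    open import Relation.Nullary using (¬_)
    open import Data.Nat using () renaming (_+_ to _ℕ+_)

-- ⌈ x / 2 ⌉ for integers (ℤ division by a positive divisor is floor division)
ceilHalf : ℤ → ℤ
ceilHalf x = (x ℤ.+ + 1) ℤ./ + 2

ContainsKrsMinDeg : ∀ {n} → Graph n → ℕ → ℕ → ℤ → Set
ContainsKrsMinDeg {n} G r s t =
  Σ (Fin r → Fin n) λ f → Σ (Fin s → Fin n) λ g →
    (∀ i j → f i ≡ f j → i ≡ j) ×
    (∀ i j → g i ≡ g j → i ≡ j) ×
    (∀ i j → ¬ (f i ≡ g j)) ×
    (∀ i j → f i ∼ g j within G) ×
    (∀ i → t ℤ.≤ + deg G (f i)) ×
    (∀ j → t ℤ.≤ + deg G (g j))
  where
    open import Data.Product using (Σ; _×_)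
    open import Relation.Nullary using (¬_)

module Submission where

-- We show that the first alternative always holds: for n large, G contains a copy of
-- K_{r,s} all of whose vertices have degree at least T = ⌈(n - m) / 2⌉ + r.
--
-- Call a vertex low if its degree is below T, high otherwise.  The bound on D(G) says that
-- two distinct non-adjacent vertices have degree sum at least 2T - 1, so the low vertices
-- form a clique.  A low vertex then has at most T - ℓ high neighbours (ℓ = number of low
-- vertices), so at most ℓ (T - ℓ) ≤ T² / 4 edges join low to high vertices.  Hence at most
-- T / 2 high vertices have more than T / 2 low neighbours; the remaining ("good") high
-- vertices make up at least n / 8 of the graph and each has at least n / 8 + r high
-- neighbours.  A greedy Kővári–Sós–Turán argument then finds r high vertices with at least
-- s common good neighbours as soon as n ≥ s·8^(r+1).

open import Defs hiding (sym)

module DenseBicliques where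

  open import Data.Nat
  open import Data.Nat.Properties
  open import Data.Bool using (Bool; true; false; _∧_; not; if_then_else_)
  open import Data.Fin using (Fin; zero; suc) renaming (_≟_ to _≟ᶠ_)
  open import Data.Fin.Properties using () renaming (suc-injective to sucᶠ-injective)
  open import Data.Product using (Σ; ∃; _×_; _,_; proj₁; proj₂)
  open import Data.Empty using (⊥-elim)
  open import Relation.Binary.PropositionalEquality
  open import Relation.Nullary using (¬_; yes; no)
  open import Relation.Nullary.Decidable using (⌊_⌋)
  open import Algebra.Properties.CommutativeMonoid.Sum +-0-commutativeMonoid
    using (sum; sum-syntax; sum-cong-≗; sum-replicate-zero; ∑-distrib-+; ∑-comm)
  open import Algebra.Properties.CommutativeSemigroup +-commutativeSemigroup using (interchange)
  open import Algebra.Properties.CommutativeSemigroup *-commutativeSemigroup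
    using () renaming (x∙yz≈y∙xz to x*yz≡y*xz; interchange to interchange-*)
  open import Function using (_∘_)
  open import Data.Nat.DivMod using (_/_; m/n*n≤m; m≡m%n+[m/n]*n; m%n<n)
  open import Data.Nat.Tactic.RingSolver using (solve-∀)
  open import Data.Sum using (inj₁; inj₂)
  import Data.Integer as ℤ using (+_; +≤+)
  open import Data.Vec using (tabulate)
  open import Data.Fin.Subset using (∣_∣)

  infix  4 _∈_ _⊆_
  infixl 6 _∩_ _∖_

  VSet : ℕ → Set
  VSet n = Fin n → Bool

  _∈_ : ∀ {n} → Fin n → VSet n → Set
  x ∈ P = P x ≡ true

  _⊆_ : ∀ {n} → VSet n → VSet n → Set
  P ⊆ Q = ∀ x → x ∈ P → x ∈ Q

  _∩_ : ∀ {n} → VSet n → VSet n → VSet n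
  (P ∩ Q) x = P x ∧ Q x

  ∁ : ∀ {n} → VSet n → VSet n
  ∁ P x = not (P x)

  _∖_ : ∀ {n} → VSet n → Fin n → VSet n
  (P ∖ v) x = P x ∧ not ⌊ x ≟ᶠ v ⌋

  -- Membership in P ∩ Q and P ∖ v, stated on the underlying Booleans so that
  -- the sets involved can be inferred.
  ∧-elim : ∀ {a b} → a ∧ b ≡ true → a ≡ true × b ≡ true
  ∧-elim {true} b≡true = refl , b≡true

  ∧-intro : ∀ {a b} → a ≡ true → b ≡ true → a ∧ b ≡ true
  ∧-intro refl b≡true = b≡true

  ∖-elim : ∀ {n} {a} {x v : Fin n} → a ∧ not ⌊ x ≟ᶠ v ⌋ ≡ true → a ≡ true × x ≢ v
  ∖-elim {a = true} {x} {v} x∈ with x ≟ᶠ v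
  ... | no x≢v = refl , x≢v

  ∖-intro : ∀ {n} {a} {x v : Fin n} → a ≡ true → x ≢ v → a ∧ not ⌊ x ≟ᶠ v ⌋ ≡ true
  ∖-intro {x = x} {v} refl x≢v with x ≟ᶠ v
  ... | yes x≡v = ⊥-elim (x≢v x≡v)
  ... | no  _   = refl

  ≤?-true : ∀ {m k} → ⌊ m ≤? k ⌋ ≡ true → m ≤ k
  ≤?-true {m} {k} m≤k with m ≤? k
  ... | yes m≤k = m≤k

  ≤?-false : ∀ {m k} → not ⌊ m ≤? k ⌋ ≡ true → k < m
  ≤?-false {m} {k} m≰k with m ≤? k
  ... | no m≰k = ≰⇒> m≰k

  sumOver : ∀ {n} → VSet n → (Fin n → ℕ) → ℕ
  sumOver {n} P w = ∑[ x < n ] (if P x then w x else 0)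

  #_ : ∀ {n} → VSet n → ℕ
  # P = sumOver P (λ _ → 1)

  ∑-mono : ∀ {n} {f g : Fin n → ℕ} → (∀ x → f x ≤ g x) → sum f ≤ sum g
  ∑-mono {zero}  f≤g = z≤n
  ∑-mono {suc n} f≤g = +-mono-≤ (f≤g zero) (∑-mono (λ x → f≤g (suc x)))

  if-mono : ∀ {b c : Bool} w → (b ≡ true → c ≡ true) → (if b then w else 0) ≤ (if c then w else 0)
  if-mono {false}     w b⇒c = z≤n
  if-mono {true}  {c} w b⇒c rewrite b⇒c refl = ≤-refl

  sumOver-mono : ∀ {n} {P Q : VSet n} (w : Fin n → ℕ) → P ⊆ Q → sumOver P w ≤ sumOver Q w
  sumOver-mono w P⊆Q = ∑-mono (λ x → if-mono (w x) (P⊆Q x))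

  #-mono : ∀ {n} {P Q : VSet n} → P ⊆ Q → # P ≤ # Q
  #-mono = sumOver-mono (λ _ → 1)

  sumOver-split : ∀ {n} (Q P : VSet n) (w : Fin n → ℕ) →
                  sumOver P w ≡ sumOver (Q ∩ P) w + sumOver (∁ Q ∩ P) w
  sumOver-split Q P w = trans (sum-cong-≗ pointwise)
    (∑-distrib-+ (λ x → if Q x ∧ P x then w x else 0) (λ x → if not (Q x) ∧ P x then w x else 0))
    where
    pointwise : ∀ x → (if P x then w x else 0) ≡
                      (if Q x ∧ P x then w x else 0) + (if not (Q x) ∧ P x then w x else 0)
    pointwise x with Q x | P x
    ... | true  | true  = sym (+-identityʳ (w x))
    ... | false | true  = refl
    ... | true  | false = refl
    ... | false | false = refl

  #-complement : ∀ {n} (Q : VSet n) → # Q + # (∁ Q) ≡ n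
  #-complement {zero}  Q = refl
  #-complement {suc n} Q with Q zero
  ... | true  = cong suc (#-complement (Q ∘ suc))
  ... | false = trans (+-suc (# (Q ∘ suc)) _) (cong suc (#-complement (Q ∘ suc)))

  sumOver-lower : ∀ {n} (P : VSet n) (w : Fin n → ℕ) c →
                  (∀ x → x ∈ P → c ≤ w x) → # P * c ≤ sumOver P w
  sumOver-lower {zero}  P w c c≤w = z≤n
  sumOver-lower {suc n} P w c c≤w with P zero in 0∈P
  ... | true  = +-mono-≤ (c≤w zero 0∈P) (sumOver-lower (P ∘ suc) (w ∘ suc) c (c≤w ∘ suc))
  ... | false = sumOver-lower (P ∘ suc) (w ∘ suc) c (c≤w ∘ suc)

  sumOver-upper : ∀ {n} (P : VSet n) (w : Fin n → ℕ) c T →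
                  (∀ x → x ∈ P → w x + c ≤ T) → sumOver P w + # P * c ≤ # P * T
  sumOver-upper {zero}  P w c T w+c≤T = z≤n
  sumOver-upper {suc n} P w c T w+c≤T with P zero in 0∈P
  ... | true  = begin
    (w zero + rest) + (c + # (P ∘ suc) * c) ≡⟨ interchange (w zero) rest c _ ⟩
    (w zero + c) + (rest + # (P ∘ suc) * c) ≤⟨ +-mono-≤ (w+c≤T zero 0∈P) (sumOver-upper (P ∘ suc) (w ∘ suc) c T (w+c≤T ∘ suc)) ⟩
    T + # (P ∘ suc) * T                      ∎
    where
    open ≤-Reasoning
    rest = sumOver (P ∘ suc) (w ∘ suc)
  ... | false = sumOver-upper (P ∘ suc) (w ∘ suc) c T (w+c≤T ∘ suc)

  #-excluding : ∀ {n} (P Q : VSet n) (v : Fin n) → (∀ x → x ∈ P → x ≢ v → x ∈ Q) → # P ≤ suc (# Q)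
  #-excluding {suc n} P Q zero P∖v⊆Q = begin
    (if P zero then 1 else 0) + # (P ∘ suc) ≤⟨ +-mono-≤ (indicator≤1 (P zero)) tail≤ ⟩
    suc (# (Q ∘ suc))                        ≤⟨ s≤s (m≤n+m _ _) ⟩
    suc (# Q)                                ∎
    where
    open ≤-Reasoning
    indicator≤1 : ∀ b → (if b then 1 else 0) ≤ 1
    indicator≤1 true  = ≤-refl
    indicator≤1 false = z≤n
    tail≤ : # (P ∘ suc) ≤ # (Q ∘ suc)
    tail≤ = #-mono (λ x x∈P → P∖v⊆Q (suc x) x∈P (λ ()))
  #-excluding {suc n} P Q (suc v) P∖v⊆Q = begin
    (if P zero then 1 else 0) + # (P ∘ suc)       ≤⟨ +-mono-≤ head≤ tail≤ ⟩
    (if Q zero then 1 else 0) + suc (# (Q ∘ suc)) ≡⟨ +-suc _ _ ⟩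
    suc (# Q)                                     ∎
    where
    open ≤-Reasoning
    head≤ = if-mono 1 (λ 0∈P → P∖v⊆Q zero 0∈P (λ ()))
    tail≤ = #-excluding (P ∘ suc) (Q ∘ suc) v (λ x x∈P x≢v → P∖v⊆Q (suc x) x∈P (x≢v ∘ sucᶠ-injective))

  #-witness : ∀ {n} (P : VSet n) → 0 < # P → ∃ λ x → x ∈ P
  #-witness {suc n} P 0<#P with P zero in 0∈P
  ... | true  = zero , 0∈P
  ... | false with #-witness (P ∘ suc) 0<#P
  ...   | x , x∈P = suc x , x∈P

  #-enumerate : ∀ {n} (P : VSet n) s → s ≤ # P →
                Σ (Fin s → Fin n) λ g → (∀ i j → g i ≡ g j → i ≡ j) × (∀ j → g j ∈ P)
  #-enumerate P zero s≤#P = (λ ()) , (λ ()) , (λ ())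
  #-enumerate {suc n} P (suc s) s≤#P with P zero in 0∈P
  ... | false with #-enumerate (P ∘ suc) (suc s) s≤#P
  ...   | g , g-inj , g∈P = suc ∘ g , (λ i j eq → g-inj i j (sucᶠ-injective eq)) , g∈P
  #-enumerate {suc n} P (suc s) s≤#P | true with #-enumerate (P ∘ suc) s (≤-pred s≤#P)
  ...   | g , g-inj , g∈P = g′ , g′-inj , g′∈P
    where
    g′ : Fin (suc s) → Fin (suc n)
    g′ zero    = zero
    g′ (suc j) = suc (g j)
    g′-inj : ∀ i j → g′ i ≡ g′ j → i ≡ j
    g′-inj zero    zero    _  = refl
    g′-inj (suc i) (suc j) eq = cong suc (g-inj i j (sucᶠ-injective eq))
    g′∈P : ∀ j → g′ j ∈ P
    g′∈P zero    = 0∈P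
    g′∈P (suc j) = g∈P j

  largest-term : ∀ {n} → Fin n → (f : Fin n → ℕ) → ∃ λ x → sum f ≤ n * f x
  largest-term {suc zero}    _ f = zero , ≤-refl
  largest-term {suc (suc n)} _ f with largest-term {suc n} zero (f ∘ suc)
  ... | x , tail≤ with f zero ≤? f (suc x)
  ...   | yes f0≤fx = suc x , +-mono-≤ f0≤fx tail≤
  ...   | no  f0≰fx = zero , +-monoʳ-≤ (f zero) (≤-trans tail≤ (*-monoʳ-≤ (suc n) (<⇒≤ (≰⇒> f0≰fx))))

  deg≡# : ∀ {n} (G : Graph n) v → deg G v ≡ # (adj G v)
  deg≡# G v = ∣tabulate∣ (adj G v)
    where
    ∣tabulate∣ : ∀ {n} (P : VSet n) → ∣ tabulate P ∣ ≡ # P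
    ∣tabulate∣ {zero}  P = refl
    ∣tabulate∣ {suc n} P with P zero
    ... | true  = cong suc (∣tabulate∣ (P ∘ suc))
    ... | false = ∣tabulate∣ (P ∘ suc)

  edges : ∀ {n} → Graph n → VSet n → VSet n → ℕ
  edges G P Q = sumOver P (λ x → # (Q ∩ adj G x))

  edges-sym : ∀ {n} (G : Graph n) (P Q : VSet n) → edges G P Q ≡ edges G Q P
  edges-sym {n} G P Q = begin
    edges G P Q                                                     ≡⟨ sum-cong-≗ (λ x → if-∑ (P x) _) ⟩
    ∑[ x < n ] ∑[ y < n ] (if P x then edge Q x y else 0)           ≡⟨ ∑-comm (λ x y → if P x then edge Q x y else 0) ⟩
    ∑[ y < n ] ∑[ x < n ] (if P x then edge Q x y else 0)           ≡⟨ sum-cong-≗ (λ y → sum-cong-≗ (λ x → transpose x y)) ⟩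
    ∑[ y < n ] ∑[ x < n ] (if Q y then edge P y x else 0)           ≡⟨ sum-cong-≗ (λ y → if-∑ (Q y) _) ⟨
    edges G Q P                                                     ∎
    where
    open ≡-Reasoning
    edge : VSet n → Fin n → Fin n → ℕ
    edge R x y = if R y ∧ adj G x y then 1 else 0
    if-∑ : ∀ b (f : Fin n → ℕ) → (if b then sum f else 0) ≡ ∑[ y < n ] (if b then f y else 0)
    if-∑ true  f = refl
    if-∑ false f = sym (sum-replicate-zero n)
    transpose : ∀ x y → (if P x then edge Q x y else 0) ≡ (if Q y then edge P y x else 0)
    transpose x y rewrite Graph.sym G x y with P x | Q y
    ... | true  | true  = refl
    ... | true  | false = refl
    ... | false | true  = refl
    ... | false | false = refl

  0<*-intro : ∀ {a b} → 0 < a → 0 < b → 0 < a * b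
  0<*-intro {suc a} {suc b} _ _ = z<s

  0<*-elimˡ : ∀ {a b} → 0 < a * b → 0 < a
  0<*-elimˡ {suc a} _ = z<s

  0<*-elimʳ : ∀ a {b} → 0 < a * b → 0 < b
  0<*-elimʳ a {zero} 0<a*0 = ⊥-elim (<-irrefl (sym (*-zeroʳ a)) 0<a*0)
  0<*-elimʳ a {suc b} _    = z<s

  record Biclique {n} (G : Graph n) (k : ℕ) (X Y : VSet n) : Set where
    field
      left       : Fin k → Fin n
      right      : VSet n
      left-inj   : ∀ i j → left i ≡ left j → i ≡ j
      left⊆X     : ∀ i → left i ∈ X
      right⊆Y    : right ⊆ Y
      complete   : ∀ i z → z ∈ right → left i ∼ z within G

  extend-biclique : ∀ {n} {G : Graph n} {k X Y} x → x ∈ X →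
                    (B : Biclique G k (X ∖ x) (Y ∩ adj G x)) →
                    Σ (Biclique G (suc k) X Y) λ B′ → Biclique.right B′ ≡ Biclique.right B
  extend-biclique {G = G} {k} {X} {Y} x x∈X B = record
    { left = left′ ; right = right ; left-inj = left′-inj ; left⊆X = left′⊆X
    ; right⊆Y = λ z z∈ → proj₁ (∧-elim (right⊆Y z z∈)) ; complete = complete′ } , refl
    where
    open Biclique B
    left′ : Fin (suc k) → Fin _
    left′ zero    = x
    left′ (suc i) = left i
    left′-inj : ∀ i j → left′ i ≡ left′ j → i ≡ j
    left′-inj zero    zero    _  = refl
    left′-inj zero    (suc j) eq = ⊥-elim (proj₂ (∖-elim (left⊆X j)) (sym eq))
    left′-inj (suc i) zero    eq = ⊥-elim (proj₂ (∖-elim (left⊆X i)) eq)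
    left′-inj (suc i) (suc j) eq = cong suc (left-inj i j eq)
    left′⊆X : ∀ i → left′ i ∈ X
    left′⊆X zero    = x∈X
    left′⊆X (suc i) = proj₁ (∖-elim (left⊆X i))
    complete′ : ∀ i z → z ∈ right → left′ i ∼ z within G
    complete′ zero    z z∈ = proj₂ (∧-elim (right⊆Y z z∈))
    complete′ (suc i) z z∈ = complete i z z∈

  popular-vertex : ∀ {n} (G : Graph n) (X Y : VSet n) c → 0 < # Y * c →
                   (∀ y → y ∈ Y → c ≤ # (X ∩ adj G y)) →
                   ∃ λ x → x ∈ X × # Y * c ≤ n * # (Y ∩ adj G x)
  popular-vertex {n} G X Y c 0<#Y*c c≤deg with #-witness Y (0<*-elimˡ 0<#Y*c)
  ... | y , _ with largest-term y (λ x → if X x then # (Y ∩ adj G x) else 0)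
  ...   | x , edges≤ = select x (≤-trans many-edges edges≤)
    where
    many-edges : # Y * c ≤ edges G X Y
    many-edges = ≤-trans (sumOver-lower Y (λ y → # (X ∩ adj G y)) c c≤deg) (≤-reflexive (edges-sym G Y X))
    -- The chosen vertex carries positive weight, so it lies in X.
    select : ∀ x → # Y * c ≤ n * (if X x then # (Y ∩ adj G x) else 0) →
             ∃ λ x → x ∈ X × # Y * c ≤ n * # (Y ∩ adj G x)
    select x bound with X x in x∈X
    ... | true  = x , x∈X , bound
    ... | false = ⊥-elim (<-irrefl refl (<-≤-trans 0<#Y*c (≤-trans bound (≤-reflexive (*-zeroʳ n)))))

  -- One greedy step multiplies the guaranteed number of common neighbours by d / n.
  density-step : ∀ {a b z n d} k → a * d ≤ n * b → b * d ^ k ≤ z * n ^ k → a * d ^ suc k ≤ z * n ^ suc k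
  density-step {a} {b} {z} {n} {d} k ad≤nb bdᵏ≤znᵏ = begin
    a * (d * d ^ k)   ≡⟨ *-assoc a d (d ^ k) ⟨
    (a * d) * d ^ k   ≤⟨ *-monoˡ-≤ (d ^ k) ad≤nb ⟩
    (n * b) * d ^ k   ≡⟨ *-assoc n b (d ^ k) ⟩
    n * (b * d ^ k)   ≤⟨ *-monoʳ-≤ n bdᵏ≤znᵏ ⟩
    n * (z * n ^ k)   ≡⟨ x*yz≡y*xz n z (n ^ k) ⟩
    z * (n * n ^ k)   ∎
    where open ≤-Reasoning

  -- Each step picks a popular vertex of X by averaging.
  greedy-biclique : ∀ {n} (G : Graph n) k (X Y : VSet n) d → 0 < # Y →
                    (∀ y → y ∈ Y → d + k ≤ # (X ∩ adj G y)) →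
                    Σ (Biclique G k X Y) λ B → # Y * d ^ k ≤ # (Biclique.right B) * n ^ k
  greedy-biclique G zero X Y d _ _ =
    record { left = λ (); right = Y; left-inj = λ (); left⊆X = λ ()
           ; right⊆Y = λ _ z∈Y → z∈Y; complete = λ () } , ≤-refl
  greedy-biclique {n} G (suc k) X Y d 0<#Y deg≥
    with popular-vertex G X Y (d + suc k) (0<*-intro 0<#Y (<-≤-trans z<s (m≤n+m (suc k) d))) deg≥
  ... | x , x∈X , popular = grow
    where
    Y′ = Y ∩ adj G x
    -- Inside N(x), each vertex of Y loses at most the neighbour x from X.
    deg′≥ : ∀ y → y ∈ Y′ → d + k ≤ # ((X ∖ x) ∩ adj G y)
    deg′≥ y y∈Y′ = ≤-pred (begin
      suc (d + k)             ≡⟨ +-suc d k ⟨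
      d + suc k               ≤⟨ deg≥ y (proj₁ (∧-elim {Y y} y∈Y′)) ⟩
      # (X ∩ adj G y)         ≤⟨ #-excluding (X ∩ adj G y) ((X ∖ x) ∩ adj G y) x still-neighbour ⟩
      suc (# ((X ∖ x) ∩ adj G y)) ∎)
      where
      open ≤-Reasoning
      still-neighbour : ∀ z → z ∈ X ∩ adj G y → z ≢ x → z ∈ (X ∖ x) ∩ adj G y
      still-neighbour z z∈ z≢x = let z∈X , y∼z = ∧-elim {X z} z∈ in ∧-intro (∖-intro z∈X z≢x) y∼z
    0<#Y′ : 0 < # Y′
    0<#Y′ = 0<*-elimʳ n (<-≤-trans (0<*-intro 0<#Y (<-≤-trans z<s (m≤n+m (suc k) d))) popular)
    grow : Σ (Biclique G (suc k) X Y) λ B → # Y * d ^ suc k ≤ # (Biclique.right B) * n ^ suc k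
    grow with greedy-biclique G k (X ∖ x) Y′ d 0<#Y′ deg′≥
    ... | B , bound with extend-biclique x x∈X B
    ...   | B′ , refl = B′ , density-step {# Y} {# Y′} {# (Biclique.right B)} {n} k Y-shrinks bound
      where
      Y-shrinks : # Y * d ≤ n * # Y′
      Y-shrinks = ≤-trans (*-monoʳ-≤ (# Y) (m≤m+n d (suc k))) popular

  -- Arithmetic behind dense-biclique: with |Y|, d ≥ n / 8 the guaranteed number
  -- |Y| dʳ / nʳ of common neighbours is at least n / 8^(r+1) ≥ s.
  ^-mono-8 : ∀ {n d} r → n ≤ 8 * d → n ^ r ≤ 8 ^ r * d ^ r
  ^-mono-8 zero    n≤8d = ≤-refl
  ^-mono-8 {n} {d} (suc r) n≤8d = begin
    n * n ^ r                   ≤⟨ *-mono-≤ n≤8d (^-mono-8 r n≤8d) ⟩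
    (8 * d) * (8 ^ r * d ^ r)   ≡⟨ interchange-* 8 d (8 ^ r) (d ^ r) ⟩
    (8 * 8 ^ r) * (d * d ^ r)   ∎
    where open ≤-Reasoning

  enough-common-neighbours : ∀ {n y d z} r s → 0 < n → n ≤ 8 * y → n ≤ 8 * d →
                             s * 8 ^ suc r ≤ n → y * d ^ r ≤ z * n ^ r → s ≤ z
  enough-common-neighbours {n} {y} {d} {z} r s 0<n n≤8y n≤8d large dense =
    *-cancelʳ-≤ s z (n ^ r) {{m^n≢0 n r {{>-nonZero 0<n}}}}
      (*-cancelˡ-≤ (8 ^ suc r) {{m^n≢0 8 (suc r)}} (begin
        8 ^ suc r * (s * n ^ r)       ≡⟨ x*yz≡y*xz (8 ^ suc r) s (n ^ r) ⟩
        s * (8 ^ suc r * n ^ r)       ≡⟨ *-assoc s (8 ^ suc r) (n ^ r) ⟨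
        (s * 8 ^ suc r) * n ^ r       ≤⟨ *-monoˡ-≤ (n ^ r) large ⟩
        n * n ^ r                     ≤⟨ *-mono-≤ n≤8y (^-mono-8 r n≤8d) ⟩
        (8 * y) * (8 ^ r * d ^ r)     ≡⟨ interchange-* 8 y (8 ^ r) (d ^ r) ⟩
        (8 * 8 ^ r) * (y * d ^ r)     ≤⟨ *-monoʳ-≤ (8 ^ suc r) dense ⟩
        8 ^ suc r * (z * n ^ r)       ∎))
    where open ≤-Reasoning

  dense-biclique : ∀ {n} (G : Graph n) r s (X Y : VSet n) d →
                   0 < n → n ≤ 8 * # Y → n ≤ 8 * d → s * 8 ^ suc r ≤ n →
                   (∀ y → y ∈ Y → d + r ≤ # (X ∩ adj G y)) →
                   Σ (Biclique G r X Y) λ B → s ≤ # (Biclique.right B)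
  dense-biclique {n} G r s X Y d 0<n n≤8#Y n≤8d large deg≥
    with greedy-biclique G r X Y d (0<*-elimʳ 8 (<-≤-trans 0<n n≤8#Y)) deg≥
  ... | B , dense = B , enough-common-neighbours {y = # Y} r s 0<n n≤8#Y n≤8d large dense

  biclique⇒Krs : ∀ {n} {G : Graph n} {r X Y} s T (B : Biclique G r X Y) → s ≤ # (Biclique.right B) →
                 (∀ v → v ∈ X → T ≤ deg G v) → (∀ v → v ∈ Y → T ≤ deg G v) →
                 ContainsKrsMinDeg G r s (ℤ.+ T)
  biclique⇒Krs {G = G} s T B s≤#right X-deg Y-deg with #-enumerate (Biclique.right B) s s≤#right
  ... | g , g-inj , g∈right =
    left , g , left-inj , g-inj , left≢g , (λ i j → complete i (g j) (g∈right j)) ,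
    (λ i → ℤ.+≤+ (X-deg (left i) (left⊆X i))) , (λ j → ℤ.+≤+ (Y-deg (g j) (right⊆Y (g j) (g∈right j))))
    where
    open Biclique B
    -- Adjacent vertices are distinct since G has no loops.
    left≢g : ∀ i j → left i ≢ g j
    left≢g i j left≡g
      with trans (sym (irrefl G (g j))) (subst (λ u → u ∼ g j within G) left≡g (complete i (g j) (g∈right j)))
    ... | ()

  halves : ∀ x → x / 2 + x / 2 ≤ x × x ≤ suc (x / 2 + x / 2)
  halves x = ≤-trans (≤-reflexive (sym (double (x / 2)))) (m/n*n≤m x 2) ,
             ≤-trans (≤-reflexive (m≡m%n+[m/n]*n x 2)) (+-mono-≤ (≤-pred (m%n<n x 2)) (≤-reflexive (double (x / 2))))
    where
    double : ∀ m → m * 2 ≡ m + m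
    double = solve-∀

  half-mono : ∀ {x y} → x + x ≤ y + y → x ≤ y
  half-mono {x} {y} x+x≤y+y with x ≤? y
  ... | yes x≤y = x≤y
  ... | no  x≰y = ⊥-elim (<⇒≱ (+-mono-< (≰⇒> x≰y) (≰⇒> x≰y)) x+x≤y+y)

  half-strict : ∀ {x y} → x + x < y + y → x < y
  half-strict {x} {y} x+x<y+y with x <? y
  ... | yes x<y = x<y
  ... | no  x≮y = ⊥-elim (<⇒≱ x+x<y+y (+-mono-≤ (≮⇒≥ x≮y) (≮⇒≥ x≮y)))

  two-products : ∀ u y → 2 * (u * y) ≤ y * y + u * u
  two-products u y with ≤-total u y
  ... | inj₁ u≤y with m≤n⇒∃[o]m+o≡n u≤y
  ...   | c , refl = ≤-trans (m≤m+n _ (c * c)) (≤-reflexive (gap u c))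
    where
    gap : ∀ u c → 2 * (u * (u + c)) + c * c ≡ (u + c) * (u + c) + u * u
    gap = solve-∀
  two-products u y | inj₂ y≤u with m≤n⇒∃[o]m+o≡n y≤u
  ...   | c , refl = ≤-trans (m≤m+n _ (c * c)) (≤-reflexive (gap y c))
    where
    gap : ∀ y c → 2 * ((y + c) * y) + c * c ≡ y * y + (y + c) * (y + c)
    gap = solve-∀

  am-gm : ∀ x y → 4 * (x * y) ≤ y * y + 4 * (x * x)
  am-gm x y = begin
    4 * (x * y)                 ≡⟨ four-xy x y ⟩
    2 * ((x + x) * y)           ≤⟨ two-products (x + x) y ⟩
    y * y + (x + x) * (x + x)   ≡⟨ cong (_+_ (y * y)) (four-xx x) ⟩
    y * y + 4 * (x * x)         ∎
    where
    open ≤-Reasoning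
    four-xy : ∀ x y → 4 * (x * y) ≡ 2 * ((x + x) * y)
    four-xy = solve-∀
    four-xx : ∀ x → (x + x) * (x + x) ≡ 4 * (x * x)
    four-xx = solve-∀

  -- If b vertices each send more than K ≥ (T - 1) / 2 edges into a set of ℓ vertices which
  -- receive at most ℓ (T - ℓ) ≤ T² / 4 edges in total, then b ≤ T / 2.
  few-crowded : ∀ {T K b e ℓ} → 0 < T → T ≤ suc (K + K) → b * suc K ≤ e → e + ℓ * ℓ ≤ ℓ * T → b + b ≤ T
  few-crowded {T} {K} {b} {e} {ℓ} 0<T T≤2K+1 b[K+1]≤e e+ℓ²≤ℓT =
    *-cancelˡ-≤ T {{>-nonZero 0<T}} (begin
      T * (b + b)                 ≤⟨ *-monoˡ-≤ (b + b) (≤-trans T≤2K+1 (s≤s (+-monoʳ-≤ K (n≤1+n K)))) ⟩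
      (suc K + suc K) * (b + b)   ≡⟨ four-products K b ⟩
      4 * (b * suc K)             ≤⟨ *-monoʳ-≤ 4 b[K+1]≤e ⟩
      4 * e                       ≤⟨ +-cancelʳ-≤ (4 * (ℓ * ℓ)) (4 * e) (T * T) 4e+4ℓ²≤T²+4ℓ² ⟩
      T * T                       ∎)
    where
    open ≤-Reasoning
    four-products : ∀ K b → (suc K + suc K) * (b + b) ≡ 4 * (b * suc K)
    four-products = solve-∀
    distrib-4 : ∀ e l → 4 * (e + l * l) ≡ 4 * e + 4 * (l * l)
    distrib-4 = solve-∀
    4e+4ℓ²≤T²+4ℓ² : 4 * e + 4 * (ℓ * ℓ) ≤ T * T + 4 * (ℓ * ℓ)
    4e+4ℓ²≤T²+4ℓ² = begin
      4 * e + 4 * (ℓ * ℓ) ≡⟨ distrib-4 e ℓ ⟨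
      4 * (e + ℓ * ℓ)     ≤⟨ *-monoʳ-≤ 4 e+ℓ²≤ℓT ⟩
      4 * (ℓ * T)         ≤⟨ am-gm ℓ T ⟩
      T * T + 4 * (ℓ * ℓ) ∎

  many-sparse : ∀ {n a T g b ℓ} → g + b + ℓ ≡ n → b + b ≤ T → ℓ ≤ T → T + T ≤ n + a → 6 * a ≤ n →
                n ≤ 8 * g
  many-sparse {a = a} {T} {g} {b} {ℓ} refl 2b≤T ℓ≤T 2T≤n+a 6a≤n = +-cancelʳ-≤ (7 * n) n (8 * g) (begin
    n + 7 * n                          ≡⟨ expand g b ℓ ⟩
    8 * g + (4 * (b + b) + 8 * ℓ)      ≤⟨ +-monoʳ-≤ (8 * g) (+-mono-≤ (*-monoʳ-≤ 4 2b≤T) (*-monoʳ-≤ 8 ℓ≤T)) ⟩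
    8 * g + (4 * T + 8 * T)            ≡⟨ cong (_+_ (8 * g)) (twelve T) ⟩
    8 * g + 6 * (T + T)                ≤⟨ +-monoʳ-≤ (8 * g) (*-monoʳ-≤ 6 2T≤n+a) ⟩
    8 * g + 6 * (n + a)                ≡⟨ cong (_+_ (8 * g)) (*-distribˡ-+ 6 n a) ⟩
    8 * g + (6 * n + 6 * a)            ≤⟨ +-monoʳ-≤ (8 * g) (+-monoʳ-≤ (6 * n) 6a≤n) ⟩
    8 * g + (6 * n + n)                ≡⟨ cong (_+_ (8 * g)) (seven n) ⟩
    8 * g + 7 * n                      ∎)
    where
    open ≤-Reasoning
    n = g + b + ℓ
    expand : ∀ g b ℓ → (g + b + ℓ) + 7 * (g + b + ℓ) ≡ 8 * g + (4 * (b + b) + 8 * ℓ)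
    expand = solve-∀
    twelve : ∀ T → 4 * T + 8 * T ≡ 6 * (T + T)
    twelve = solve-∀
    seven : ∀ n → 6 * n + n ≡ 7 * n
    seven = solve-∀

  surplus-large : ∀ {n a T d r K} → K + r + d ≡ T → K + K ≤ T → n ≤ T + T + a → 8 * r + 2 * a ≤ n →
                  n ≤ 8 * d
  surplus-large {n} {a} {d = d} {r} {K} refl 2K≤T n≤2T+a 8r+2a≤n = +-cancelʳ-≤ n n (8 * d) (begin
    n + n                         ≤⟨ +-mono-≤ n≤2T+a n≤2T+a ⟩
    (T + T + a) + (T + T + a)     ≡⟨ regroup T a ⟩
    4 * T + 2 * a                 ≤⟨ +-monoˡ-≤ (2 * a) (*-monoʳ-≤ 4 T≤2[d+r]) ⟩
    4 * (2 * (d + r)) + 2 * a     ≡⟨ expand d r a ⟩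
    8 * d + (8 * r + 2 * a)       ≤⟨ +-monoʳ-≤ (8 * d) 8r+2a≤n ⟩
    8 * d + n                     ∎)
    where
    open ≤-Reasoning
    T = K + r + d
    regroup : ∀ T a → (T + T + a) + (T + T + a) ≡ 4 * T + 2 * a
    regroup = solve-∀
    expand : ∀ d r a → 4 * (2 * (d + r)) + 2 * a ≡ 8 * d + (8 * r + 2 * a)
    expand = solve-∀
    split-T : ∀ K r d → (K + r + d) + (K + r + d) ≡ (K + K) + 2 * (d + r)
    split-T = solve-∀
    T≤2[d+r] : T ≤ 2 * (d + r)
    T≤2[d+r] = +-cancelˡ-≤ T T (2 * (d + r)) (begin
      T + T                   ≡⟨ split-T K r d ⟩
      (K + K) + 2 * (d + r)   ≤⟨ +-monoˡ-≤ (2 * (d + r)) 2K≤T ⟩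
      T + 2 * (d + r)         ∎)

  -- Any two distinct non-adjacent vertices have degree sum at least 2T - 1, so the low
  -- vertices form a clique; hence few edges leave them, most high vertices have few low
  -- neighbours, and those vertices are dense enough among the high ones to carry a K_{r,s}.
  module LowDegreeClique {n} (G : Graph n) (T : ℕ)
    (degree-sum : ∀ v w → v ≢ w → ¬ (v ∼ w within G) → T + T ≤ suc (deg G v + deg G w)) where

    low high : VSet n
    low v = ⌊ suc (deg G v) ≤? T ⌋
    high = ∁ low

    high-degree : ∀ v → v ∈ high → T ≤ deg G v
    high-degree v v∈high = ≤-pred (≤?-false v∈high)

    low-clique : ∀ u w → u ∈ low → w ∈ low → u ≢ w → u ∼ w within G
    low-clique u w u∈low w∈low u≢w with adj G u w in u≁w
    ... | true  = refl
    ... | false = ⊥-elim (1+n≰n (begin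
      suc (suc (deg G u + deg G w)) ≡⟨ cong suc (+-suc (deg G u) (deg G w)) ⟨
      suc (deg G u) + suc (deg G w) ≤⟨ +-mono-≤ (≤?-true u∈low) (≤?-true w∈low) ⟩
      T + T                         ≤⟨ degree-sum u w u≢w (λ u∼w → false≢true (trans (sym u≁w) u∼w)) ⟩
      suc (deg G u + deg G w)       ∎))
      where
      open ≤-Reasoning
      false≢true : false ≢ true
      false≢true ()

    ℓ : ℕ
    ℓ = # low

    deg-split : ∀ v → deg G v ≡ # (low ∩ adj G v) + # (high ∩ adj G v)
    deg-split v = trans (deg≡# G v) (sumOver-split low (adj G v) (λ _ → 1))

    -- A low vertex l is adjacent to the other low vertices, so its high neighbours
    -- together with all low vertices number at most deg l + 1 ≤ T.
    low-budget : ∀ l → l ∈ low → # (high ∩ adj G l) + ℓ ≤ T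
    low-budget l l∈low = begin
      # (high ∩ adj G l) + ℓ                         ≤⟨ +-monoʳ-≤ _ (#-excluding low (low ∩ adj G l) l other-low) ⟩
      # (high ∩ adj G l) + suc (# (low ∩ adj G l))   ≡⟨ +-suc _ _ ⟩
      suc (# (high ∩ adj G l) + # (low ∩ adj G l))   ≡⟨ cong suc (trans (+-comm (# (high ∩ adj G l)) _) (sym (deg-split l))) ⟩
      suc (deg G l)                                  ≤⟨ ≤?-true l∈low ⟩
      T                                              ∎
      where
      open ≤-Reasoning
      other-low : ∀ x → x ∈ low → x ≢ l → x ∈ low ∩ adj G l
      other-low x x∈low x≢l = ∧-intro x∈low (low-clique l x l∈low x∈low (x≢l ∘ sym))

    ℓ≤T : ℓ ≤ T
    ℓ≤T with 0 <? ℓ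
    ... | yes 0<ℓ = let l , l∈low = #-witness low 0<ℓ in ≤-trans (m≤n+m ℓ _) (low-budget l l∈low)
    ... | no  0≮ℓ = ≤-trans (≮⇒≥ 0≮ℓ) z≤n

    cross : ℕ
    cross = edges G high low

    cross-upper : cross + ℓ * ℓ ≤ ℓ * T
    cross-upper = subst (λ e → e + ℓ * ℓ ≤ ℓ * T) (edges-sym G low high)
                    (sumOver-upper low (λ l → # (high ∩ adj G l)) ℓ T low-budget)

    K : ℕ
    K = T / 2

    sparse good crowded : VSet n
    sparse y = ⌊ # (low ∩ adj G y) ≤? K ⌋
    good     = sparse ∩ high
    crowded  = ∁ sparse ∩ high

    cross-lower : # crowded * suc K ≤ cross
    cross-lower = ≤-trans
      (sumOver-lower crowded (λ y → # (low ∩ adj G y)) (suc K) (λ y y∈ → ≤?-false (proj₁ (∧-elim {not (sparse y)} y∈))))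
      (sumOver-mono (λ y → # (low ∩ adj G y)) (λ y y∈ → proj₂ (∧-elim {not (sparse y)} y∈)))

    few-crowded-vertices : 0 < T → # crowded + # crowded ≤ T
    few-crowded-vertices 0<T = few-crowded {T} {K} {# crowded} {cross} {ℓ} 0<T (proj₂ (halves T)) cross-lower cross-upper

    partition : # good + # crowded + ℓ ≡ n
    partition = begin
      # good + # crowded + ℓ  ≡⟨ cong (_+ ℓ) (sumOver-split sparse high (λ _ → 1)) ⟨
      # high + ℓ              ≡⟨ +-comm (# high) ℓ ⟩
      ℓ + # high              ≡⟨ #-complement low ⟩
      n                       ∎
      where open ≡-Reasoning

    good-degree : ∀ {r d} → K + r + d ≡ T → ∀ y → y ∈ good → d + r ≤ # (high ∩ adj G y)
    good-degree {r} {d} K+r+d≡T y y∈good = +-cancelˡ-≤ K (d + r) _ (begin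
      K + (d + r)                             ≡⟨ cong (K +_) (+-comm d r) ⟩
      K + (r + d)                             ≡⟨ +-assoc K r d ⟨
      K + r + d                               ≡⟨ K+r+d≡T ⟩
      T                                       ≤⟨ high-degree y y∈high ⟩
      deg G y                                 ≡⟨ deg-split y ⟩
      # (low ∩ adj G y) + # (high ∩ adj G y)  ≤⟨ +-monoˡ-≤ _ (≤?-true y∈sparse) ⟩
      K + # (high ∩ adj G y)                  ∎)
      where
      open ≤-Reasoning
      y∈sparse = proj₁ (∧-elim {sparse y} y∈good)
      y∈high   = proj₂ (∧-elim {sparse y} y∈good)

    -- With T ≈ n / 2 up to the slack a, and n large in terms of r, s and a, the high
    -- vertices contain a K_{r,s}: the good vertices form at least an eighth of the graph
    -- and each has at least n / 8 + r high neighbours.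
    high-biclique : ∀ r s a → T + T ≤ n + a → n ≤ T + T + a →
                    s * 8 ^ suc r ≤ n → 6 * a ≤ n → 8 * r + 2 * a ≤ n → (r + r) + (r + r) + a < n →
                    ContainsKrsMinDeg G r s (ℤ.+ T)
    high-biclique r s a 2T≤n+a n≤2T+a large-s 6a≤n 8r+2a≤n 4r+a<n =
      let d , K+r+d≡T  = m≤n⇒∃[o]m+o≡n K+r≤T
          B , s≤#right = dense-biclique G r s high good d 0<n n≤8#good
                           (surplus-large {n} {a} {T} {d} {r} {K} K+r+d≡T K+K≤T n≤2T+a 8r+2a≤n) large-s (good-degree K+r+d≡T)
      in biclique⇒Krs s T B s≤#right high-degree (λ v v∈good → high-degree v (proj₂ (∧-elim {sparse v} v∈good)))
      where
      0<n : 0 < n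
      0<n = ≤-<-trans z≤n 4r+a<n
      2r<T : r + r < T
      2r<T = half-strict (+-cancelʳ-< a ((r + r) + (r + r)) (T + T) (<-≤-trans 4r+a<n n≤2T+a))
      K+K≤T : K + K ≤ T
      K+K≤T = proj₁ (halves T)
      K+r≤T : K + r ≤ T
      K+r≤T = half-mono (begin
        (K + r) + (K + r)   ≡⟨ interchange K r K r ⟩
        (K + K) + (r + r)   ≤⟨ +-mono-≤ K+K≤T (<⇒≤ 2r<T) ⟩
        T + T               ∎)
        where open ≤-Reasoning
      n≤8#good : n ≤ 8 * # good
      n≤8#good = many-sparse {n} {a} {T} {# good} {# crowded} {ℓ} partition (few-crowded-vertices (≤-<-trans z≤n 2r<T)) ℓ≤T 2T≤n+a 6a≤n

  -- T = ⌈q / 2⌉ + r is n / 2 + r up to the slack c of |n - q|.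
  ceil-threshold : ∀ {n q c} r → q ≤ n + c → n ≤ q + c →
                   let T = (q + 1) / 2 + r in
                   T + T ≤ suc (q + (r + r)) × T + T ≤ n + (c + suc (r + r)) × n ≤ T + T + (c + suc (r + r))
  ceil-threshold {n} {q} {c} r q≤n+c n≤q+c = 2T≤q+2r+1 , 2T≤n+a , n≤2T+a
    where
    open ≤-Reasoning
    a = c + suc (r + r)
    h = (q + 1) / 2
    T = h + r
    2T≤q+2r+1 : T + T ≤ suc (q + (r + r))
    2T≤q+2r+1 = begin
      (h + r) + (h + r)   ≡⟨ interchange h r h r ⟩
      (h + h) + (r + r)   ≤⟨ +-monoˡ-≤ (r + r) (proj₁ (halves (q + 1))) ⟩
      (q + 1) + (r + r)   ≡⟨ cong (_+ (r + r)) (+-comm q 1) ⟩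
      suc (q + (r + r))   ∎
    2T≤n+a : T + T ≤ n + a
    2T≤n+a = begin
      T + T                 ≤⟨ 2T≤q+2r+1 ⟩
      suc (q + (r + r))     ≤⟨ s≤s (+-monoˡ-≤ (r + r) q≤n+c) ⟩
      suc (n + c + (r + r)) ≡⟨ shift n c (r + r) ⟩
      n + a                 ∎
      where
      shift : ∀ n c x → suc (n + c + x) ≡ n + (c + suc x)
      shift = solve-∀
    q≤h+h : q ≤ h + h
    q≤h+h = ≤-pred (≤-trans (≤-reflexive (+-comm 1 q)) (proj₂ (halves (q + 1))))
    n≤2T+a : n ≤ T + T + a
    n≤2T+a = begin
      n             ≤⟨ n≤q+c ⟩
      q + c         ≤⟨ +-mono-≤ q≤h+h (m≤m+n c _) ⟩
      (h + h) + a   ≤⟨ +-monoˡ-≤ a (+-mono-≤ (m≤m+n h r) (m≤m+n h r)) ⟩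
      T + T + a     ∎

  size-conditions : ∀ r a → 6 * a ≤ 8 * (r + a) × 8 * r + 2 * a ≤ 8 * (r + a) × (r + r) + (r + r) + a ≤ 8 * (r + a)
  size-conditions r a =
    ≤-trans (m≤m+n (6 * a) _) (≤-reflexive (sym (split r a))) ,
    ≤-trans (m≤n+m (8 * r + 2 * a) (6 * a)) (≤-reflexive (sym (split r a))) ,
    ≤-trans (m≤m+n _ (4 * r + 7 * a)) (≤-reflexive (split′ r a))
    where
    split : ∀ r a → 8 * (r + a) ≡ 6 * a + (8 * r + 2 * a)
    split = solve-∀
    split′ : ∀ r a → (r + r) + (r + r) + a + (4 * r + 7 * a) ≡ 8 * (r + a)
    split′ = solve-∀

  -- The theorem over ℕ, with q standing for n - m and c bounding |n - q|: if distinct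
  -- non-adjacent vertices have degree sum at least q + 2r and n is large, then G contains a
  -- K_{r,s} whose vertices have degree at least ⌈q / 2⌉ + r.
  high-degree-biclique : ∀ r s c → Σ ℕ λ N₀ → ∀ n → N₀ ≤ n → (G : Graph n) (q : ℕ) →
    q ≤ n + c → n ≤ q + c →
    (∀ v w → v ≢ w → ¬ (v ∼ w within G) → q + (r + r) ≤ deg G v + deg G w) →
    ContainsKrsMinDeg G r s (ℤ.+ ((q + 1) / 2 + r))
  high-degree-biclique r s c = s * 8 ^ suc r + suc (8 * (r + a)) , λ n N₀≤n G q q≤n+c n≤q+c degree-sum →
    let 2T≤q+2r+1 , 2T≤n+a , n≤2T+a = ceil-threshold r q≤n+c n≤q+c
        6a≤L , 8r+2a≤L , 4r+a≤L      = size-conditions r a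
        large-s = ≤-trans (m≤m+n (s * 8 ^ suc r) _) N₀≤n
        L<n     = ≤-trans (m≤n+m (suc (8 * (r + a))) (s * 8 ^ suc r)) N₀≤n
    in LowDegreeClique.high-biclique G ((q + 1) / 2 + r)
         (λ v w v≢w v≁w → ≤-trans 2T≤q+2r+1 (s≤s (degree-sum v w v≢w v≁w)))
         r s a 2T≤n+a n≤2T+a large-s
         (<⇒≤ (≤-<-trans 6a≤L L<n)) (<⇒≤ (≤-<-trans 8r+2a≤L L<n)) (<-≤-trans (s≤s 4r+a≤L) L<n)
    where
    a = c + suc (r + r)

open DenseBicliques using (high-degree-biclique)
open import Data.Nat using (ℕ; _≥_)
import Data.Nat as ℕ
import Data.Nat.Properties as ℕ
open import Data.Integer using (ℤ; +_; -[1+_]; _+_; _-_; _≤_)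
import Data.Integer as ℤ
open import Data.Integer.Properties using (m-n≡m⊖n; ⊖-≥; drop‿+≤+; *-identityˡ)
open import Data.Integer.Tactic.RingSolver using (solve-∀)
open import Data.Fin.Subset using (Subset; ∣_∣)
open import Data.Product using (Σ; _×_; _,_; proj₁; proj₂)
open import Data.Sum using (_⊎_; inj₁)
open import Relation.Binary.PropositionalEquality using (_≡_; _≢_; refl; sym; trans; cong; subst)
open import Relation.Nullary using (¬_)

difference-ℕ : (m : ℤ) (n : ℕ) → ℤ.∣ m ∣ ℕ.≤ n →
               Σ ℕ λ q → + n - m ≡ + q × q ℕ.≤ n ℕ.+ ℤ.∣ m ∣ × n ℕ.≤ q ℕ.+ ℤ.∣ m ∣
difference-ℕ (+ p) n p≤n =
  n ℕ.∸ p , trans (m-n≡m⊖n n p) (⊖-≥ p≤n) , ℕ.≤-trans (ℕ.m∸n≤m n p) (ℕ.m≤m+n n p) ,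
  ℕ.≤-reflexive (sym (ℕ.m∸n+n≡m p≤n))
difference-ℕ -[1+ p ] n _ =
  n ℕ.+ ℕ.suc p , refl , ℕ.≤-refl , ℕ.≤-trans (ℕ.m≤m+n n (ℕ.suc p)) (ℕ.m≤m+n _ (ℕ.suc p))

threshold≡ : ∀ {n q r} (m : ℤ) → + n - m ≡ + q → ceilHalf (+ n - m) + + r ≡ + ((q ℕ.+ 1) ℕ./ 2 ℕ.+ r)
threshold≡ {q = q} {r} m n-m≡q rewrite n-m≡q = cong (_+ + r) (*-identityˡ (+ ((q ℕ.+ 1) ℕ./ 2)))

degree-sum-ℕ : ∀ {n q r} (m : ℤ) (G : Graph n) → DAtLeast G (+ n + + r + + r - m) → + n - m ≡ + q →
               ∀ v w → v ≢ w → ¬ (v ∼ w within G) → q ℕ.+ (r ℕ.+ r) ℕ.≤ deg G v ℕ.+ deg G w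
degree-sum-ℕ {n} {q} {r} m G D≥ n-m≡q v w v≢w v≁w =
  drop‿+≤+ (subst (_≤ + (deg G v ℕ.+ deg G w)) (trans (regroup (+ n) m (+ r)) (cong (_+ (+ r + + r)) n-m≡q))
    (D≥ v w v≢w v≁w))
  where
  regroup : ∀ x y z → x + z + z - y ≡ (x - y) + (z + z)
  regroup = solve-∀

lemma21 : (r s : ℕ) (m : ℤ) →
    Σ ℕ λ N₀ → ∀ n → n ≥ N₀ → (G : Graph n) →
      DAtLeast G (+ n + + r + + r - m) →
      ContainsKrsMinDeg G r s (ceilHalf (+ n - m) + + r)
      ⊎ Σ (Subset n) (λ A → ∣ A ∣ ≡ r × Percolating r G A)
lemma21 r s m = N₀ ℕ.+ ℤ.∣ m ∣ , λ n n≥ G D≥ →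
  let q , n-m≡q , q≤n+c , n≤q+c = difference-ℕ m n (ℕ.≤-trans (ℕ.m≤n+m _ N₀) n≥)
  in inj₁ (subst (ContainsKrsMinDeg G r s) (sym (threshold≡ m n-m≡q))
            (biclique n (ℕ.≤-trans (ℕ.m≤m+n N₀ _) n≥) G q q≤n+c n≤q+c (degree-sum-ℕ m G D≥ n-m≡q)))
  where
  N₀ = proj₁ (high-degree-biclique r s ℤ.∣ m ∣)
  biclique = proj₂ (high-degree-biclique r s ℤ.∣ m ∣)
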